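{- Let $p\geq 3$ and $k\geq 1$ be integers and let $G=K_{n_1,\dots,n_p}$ be a complete $p$-partite graph (all $n_i\geq 1$) with $\delta(G)\geq k-1$. Then \[ \gamma_{\times k}^{r}(G)\geq \left\lceil \frac{p(k-1)}{p-1}\right\rceil . \]
   Context: All graphs are finite, simple and undirected. For a graph $G=(V,E)$ and $x\in V$, $N[x]$ is the closed neighborhood. For an integer $k\geq 1$ and a graph $G$ with $\delta(G)\geq k-1$: a set $S\subseteq V$ is a $k$-tuple dominating set if $|N[x]\cap S|\geq k$ for every $x\in V$; it is a $k$-tuple restrained dominating set if moreover every vertex of $V-S$ is adjacent to at least $k$ vertices of $V-S$. $\gamma_{\times k}^{r}(G)$ denotes the minimum cardinality of a $k$-tuple restrained dominating set of $G$. -}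

module Defs where

open import Data.Nat using (ℕ; zero; suc; _+_; _*_; _∸_; _≤_; NonZero)
open import Data.Nat.DivMod using (_/_)
open import Data.Bool using (Bool; true; false; _∨_; not)
open import Data.Fin using (Fin)
open import Data.Fin.Subset using (Subset; _∈_; _∉_; _∩_; ∁; ∣_∣)
open import Data.Vec using (tabulate)
open import Relation.Nullary using (¬_; does)
open import Relation.Binary.PropositionalEquality using (_≡_)
open import Data.Product using (∃)

record Graph : Set where
  field
    order : ℕ
    adj   : Fin order → Fin order → Bool
    adj-sym : ∀ x y → adj x y ≡ adj y x
    adj-irrefl : ∀ x → adj x x ≡ false

open Graph public

module _ (G : Graph) where
  private V = Fin (order G)

  N : V → Subset (order G)
  N x = tabulate (λ y → adj G x y)

  N[_] : V → Subset (order G)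
  N[ x ] = tabulate (λ y → does (x Data.Fin.≟ y) ∨ adj G x y)

  deg : V → ℕ
  deg x = ∣ N x ∣

  MinDegreeAtLeast : ℕ → Set
  MinDegreeAtLeast m = ∀ x → m ≤ deg x

  IsKTupleDom : ℕ → Subset (order G) → Set
  IsKTupleDom k S = ∀ x → k ≤ ∣ N[ x ] ∩ S ∣

  IsKTupleRestrainedDom : ℕ → Subset (order G) → Set
  IsKTupleRestrainedDom k S =
    IsKTupleDom k S × (∀ x → x ∉ S → k ≤ ∣ N x ∩ ∁ S ∣)
    where open import Data.Product using (_×_)

-- Complete p-partite graph: vertex set Fin n, a *surjective* part map
-- part : Fin n → Fin p (so every part size n_i ≥ 1), and x ~ y iff x, y lie
-- in different parts.
completeMultipartite : (n p : ℕ) → (Fin n → Fin p) → Graph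
completeMultipartite n p part = record
  { order = n
  ; adj = λ x y → not (does (part x Data.Fin.≟ part y))
  ; adj-sym = symP
  ; adj-irrefl = irr
  }
  where
  open import Relation.Nullary using (yes; no)
  open import Relation.Binary.PropositionalEquality using (refl; sym)
  symP : ∀ x y → not (does (part x Data.Fin.≟ part y)) ≡ not (does (part y Data.Fin.≟ part x))
  symP x y with part x Data.Fin.≟ part y | part y Data.Fin.≟ part x
  ... | yes _ | yes _ = refl
  ... | no _ | no _ = refl
  ... | yes e | no ne = Data.Empty.⊥-elim (ne (sym e)) where import Data.Empty
  ... | no ne | yes e = Data.Empty.⊥-elim (ne (sym e)) where import Data.Empty
  irr : ∀ x → not (does (part x Data.Fin.≟ part x)) ≡ false
  irr x with part x Data.Fin.≟ part x
  ... | yes _ = refl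
  ... | no ne = Data.Empty.⊥-elim (ne refl) where import Data.Empty

Surjective : {n p : ℕ} → (Fin n → Fin p) → Set
Surjective {n} {p} f = ∀ (i : Fin p) → ∃ λ (x : Fin n) → f x ≡ i

⌈_/_⌉ : (a b : ℕ) → .{{NonZero b}} → ℕ
⌈ a / b ⌉ = (a + b ∸ 1) / b

-- Fix a vertex x in the i-th part. Its closed neighbourhood is x together with
-- everything outside that part, so k-tuple domination at x forces S to have at
-- least k − 1 vertices outside part i; by surjectivity this holds for all p
-- parts. Summing over the parts counts every vertex of S exactly p − 1 times,
-- whence p(k − 1) ≤ (p − 1)|S|.
module Submission where

open import Defs
open import Data.Nat using (ℕ; zero; suc; _+_; _*_; _∸_; _≤_; _≥_; z≤n; s≤s)
open import Data.Nat.Properties hiding (_≟_)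
open import Data.Nat.DivMod using (m<n*o⇒m/o<n)
open import Data.Bool using (Bool; true; false; _∧_; _∨_; not)
open import Data.Fin using (Fin; zero; suc)
open import Data.Fin.Properties using (_≟_)
open import Data.Fin.Subset using (Subset; ∣_∣; _∩_)
open import Data.Vec using ([]; _∷_; lookup)
open import Data.Vec.Properties using (lookup-zipWith; lookup∘tabulate)
open import Data.Product using (_,_)
open import Relation.Nullary using (does)
open import Function using (_∘_)
open import Relation.Binary.PropositionalEquality using (_≡_; refl; sym; trans; cong; module ≡-Reasoning)
open import Algebra.Properties.Semiring.Sum +-*-semiring
  using (sum; sum-syntax; ∑-comm; ∑-distrib-+; sum-cong-≗; *-distribˡ-sum; *-distribʳ-sum)

⟦_⟧ : Bool → ℕ
⟦ true ⟧ = 1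
⟦ false ⟧ = 0

⟦∨∧⟧≤ : ∀ a b c → ⟦ (a ∨ b) ∧ c ⟧ ≤ ⟦ a ⟧ + ⟦ b ⟧ * ⟦ c ⟧
⟦∨∧⟧≤ true  b     true  = s≤s z≤n
⟦∨∧⟧≤ true  b     false = z≤n
⟦∨∧⟧≤ false true  true  = s≤s z≤n
⟦∨∧⟧≤ false true  false = z≤n
⟦∨∧⟧≤ false false c     = z≤n

∑-mono-≤ : ∀ {n} {f g : Fin n → ℕ} → (∀ i → f i ≤ g i) → sum f ≤ sum g
∑-mono-≤ {zero}  f≤g = z≤n
∑-mono-≤ {suc n} f≤g = +-mono-≤ (f≤g zero) (∑-mono-≤ (f≤g ∘ suc))

∑-const : ∀ n k → ∑[ i < n ] k ≡ n * k
∑-const zero    k = refl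
∑-const (suc n) k = cong (k +_) (∑-const n k)

∣p∣≡∑⟦∈⟧ : ∀ {n} (p : Subset n) → ∣ p ∣ ≡ ∑[ y < n ] ⟦ lookup p y ⟧
∣p∣≡∑⟦∈⟧ []          = refl
∣p∣≡∑⟦∈⟧ (true ∷ p)  = cong suc (∣p∣≡∑⟦∈⟧ p)
∣p∣≡∑⟦∈⟧ (false ∷ p) = ∣p∣≡∑⟦∈⟧ p

∑⟦x≟y⟧≡1 : ∀ {n} (x : Fin n) → ∑[ y < n ] ⟦ does (x ≟ y) ⟧ ≡ 1
∑⟦x≟y⟧≡1 {suc n} zero    = cong suc (trans (∑-const n 0) (*-zeroʳ n))
∑⟦x≟y⟧≡1 {suc n} (suc x) = ∑⟦x≟y⟧≡1 x

∑⟦i≢a⟧≡n∸1 : ∀ {n} (a : Fin n) → ∑[ i < n ] ⟦ not (does (i ≟ a)) ⟧ ≡ n ∸ 1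
∑⟦i≢a⟧≡n∸1 {suc n}       zero    = trans (∑-const n 1) (*-identityʳ n)
∑⟦i≢a⟧≡n∸1 {suc (suc n)} (suc a) = cong suc (∑⟦i≢a⟧≡n∸1 a)

∑-outside-class : ∀ {n p} (c : Fin n → Fin p) (w : Fin n → ℕ) →
  ∑[ i < p ] ∑[ y < n ] (⟦ not (does (i ≟ c y)) ⟧ * w y) ≡ (p ∸ 1) * ∑[ y < n ] w y
∑-outside-class {n} {p} c w = begin
  ∑[ i < p ] ∑[ y < n ] (⟦ not (does (i ≟ c y)) ⟧ * w y)
    ≡⟨ ∑-comm (λ i y → ⟦ not (does (i ≟ c y)) ⟧ * w y) ⟩
  ∑[ y < n ] ∑[ i < p ] (⟦ not (does (i ≟ c y)) ⟧ * w y)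
    ≡⟨ sum-cong-≗ (λ y → sym (*-distribʳ-sum (w y) (λ i → ⟦ not (does (i ≟ c y)) ⟧))) ⟩
  ∑[ y < n ] ((∑[ i < p ] ⟦ not (does (i ≟ c y)) ⟧) * w y)
    ≡⟨ sum-cong-≗ (λ y → cong (_* w y) (∑⟦i≢a⟧≡n∸1 (c y))) ⟩
  ∑[ y < n ] ((p ∸ 1) * w y)
    ≡⟨ sym (*-distribˡ-sum (p ∸ 1) w) ⟩
  (p ∸ 1) * ∑[ y < n ] w y ∎
  where open ≡-Reasoning

⌈m/suc[o]⌉≤n : ∀ {m} n o → m ≤ suc o * n → ⌈ m / suc o ⌉ ≤ n
⌈m/suc[o]⌉≤n {m} n o m≤[1+o]*n = ≤-pred (m<n*o⇒m/o<n (begin-strict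
  m + suc o ∸ 1     ≡⟨ +-∸-assoc m (s≤s (z≤n {o})) ⟩
  m + o             <⟨ +-monoʳ-< m (n<1+n o) ⟩
  m + suc o         ≤⟨ +-monoˡ-≤ (suc o) m≤[1+o]*n ⟩
  suc o * n + suc o ≡⟨ +-comm (suc o * n) (suc o) ⟩
  suc o + suc o * n ≡⟨ *-suc (suc o) n ⟨
  suc o * suc n     ≡⟨ *-comm (suc o) (suc n) ⟩
  suc n * suc o     ∎))
  where open ≤-Reasoning

module CompleteMultipartite {n p : ℕ} (part : Fin n → Fin p) where

  G : Graph
  G = completeMultipartite n p part

  ∣S─part∣ : Subset n → Fin p → ℕ
  ∣S─part∣ S i = ∑[ y < n ] (⟦ not (does (i ≟ part y)) ⟧ * ⟦ lookup S y ⟧)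

  ∣N[x]∩S∣≤1+∣S─part∣ : ∀ S x → ∣ N[_] G x ∩ S ∣ ≤ 1 + ∣S─part∣ S (part x)
  ∣N[x]∩S∣≤1+∣S─part∣ S x = begin
    ∣ N[_] G x ∩ S ∣
      ≡⟨ ∣p∣≡∑⟦∈⟧ (N[_] G x ∩ S) ⟩
    ∑[ y < n ] ⟦ lookup (N[_] G x ∩ S) y ⟧
      ≤⟨ ∑-mono-≤ pointwise ⟩
    ∑[ y < n ] (⟦ does (x ≟ y) ⟧ + ⟦ not (does (part x ≟ part y)) ⟧ * ⟦ lookup S y ⟧)
      ≡⟨ ∑-distrib-+ (λ y → ⟦ does (x ≟ y) ⟧)
                      (λ y → ⟦ not (does (part x ≟ part y)) ⟧ * ⟦ lookup S y ⟧) ⟩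
    ∑[ y < n ] ⟦ does (x ≟ y) ⟧ + ∣S─part∣ S (part x)
      ≡⟨ cong (_+ ∣S─part∣ S (part x)) (∑⟦x≟y⟧≡1 x) ⟩
    1 + ∣S─part∣ S (part x) ∎
    where
    open ≤-Reasoning
    pointwise : ∀ y → ⟦ lookup (N[_] G x ∩ S) y ⟧
                    ≤ ⟦ does (x ≟ y) ⟧ + ⟦ not (does (part x ≟ part y)) ⟧ * ⟦ lookup S y ⟧
    pointwise y
      rewrite lookup-zipWith _∧_ y (N[_] G x) S
            | lookup∘tabulate (λ z → does (x ≟ z) ∨ not (does (part x ≟ part z))) y
      = ⟦∨∧⟧≤ (does (x ≟ y)) (not (does (part x ≟ part y))) (lookup S y)

  1+j-tupleDom⇒p*j≤[p∸1]*∣S∣ : Surjective part → ∀ j S → IsKTupleDom G (suc j) S →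
    p * j ≤ (p ∸ 1) * ∣ S ∣
  1+j-tupleDom⇒p*j≤[p∸1]*∣S∣ surj j S dom = begin
    p * j                               ≡⟨ ∑-const p j ⟨
    ∑[ i < p ] j                        ≤⟨ ∑-mono-≤ j≤∣S─part∣ ⟩
    ∑[ i < p ] ∣S─part∣ S i              ≡⟨ ∑-outside-class part (λ y → ⟦ lookup S y ⟧) ⟩
    (p ∸ 1) * ∑[ y < n ] ⟦ lookup S y ⟧ ≡⟨ cong ((p ∸ 1) *_) (∣p∣≡∑⟦∈⟧ S) ⟨
    (p ∸ 1) * ∣ S ∣                     ∎
    where
    open ≤-Reasoning
    j≤∣S─part∣ : ∀ i → j ≤ ∣S─part∣ S i
    j≤∣S─part∣ i with surj i
    ... | x , refl = ≤-pred (≤-trans (dom x) (∣N[x]∩S∣≤1+∣S─part∣ S x))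

proposition2p9 : (n q j : ℕ) → (part : Fin n → Fin (suc (suc (suc q)))) →
    Surjective part →
    MinDegreeAtLeast (completeMultipartite n (suc (suc (suc q))) part) (suc j ∸ 1) →
    (S : Subset n) →
    IsKTupleRestrainedDom (completeMultipartite n (suc (suc (suc q))) part) (suc j) S →
    ∣ S ∣ ≥ ⌈ suc (suc (suc q)) * (suc j ∸ 1) / (suc (suc (suc q)) ∸ 1) ⌉
proposition2p9 n q j part surj _ S (dom , _) =
  ⌈m/suc[o]⌉≤n ∣ S ∣ (suc q) (1+j-tupleDom⇒p*j≤[p∸1]*∣S∣ surj j S dom)
  where open CompleteMultipartite part
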